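{- Let $G$ be a connected finite simple graph of order $n$, and let $I(G)$ be the set of internal vertices of $G$ (vertices of degree at least $2$). For $u\in I(G)$ let $\operatorname{ideg}(u)$ be the internal degree of $u$, let $n_u$ be the number of neighbours of $u$ that are pendant vertices (degree $1$), let $k_u$ be the number of triangles containing $u$ in which both other vertices have degree $2$ in $G$, and let $p_u$ be the number of triangles containing $u$ in which exactly one of the other two vertices has degree $2$ in $G$. Then the number of vertices of the $2$-shunt intersection graph $A_2(G)$ is $$\sum_{u\in I(G)}\Big(n_u\,\operatorname{ideg}(u)+2\binom{\operatorname{ideg}(u)}{2}-2k_u-p_u\Big).$$
   Context: The internal degree $\operatorname{ideg}(u)$ of a vertex $u$ is $\deg_G(u)$ minus the number of pendant vertices in the closed neighbourhood $N[u]$. A $2$-arc on distinct vertices is a sequence $(x,u,y)$ of pairwise distinct vertices with $xu,uy\in E(G)$. It can be shunted onto the $2$-arc $(u,y,z)$ if $(x,u,y,z)$ consists of pairwise distinct vertices with $yz\in E(G)$. $A_2(G)$ has as vertices the $2$-arcs on distinct vertices that can be shunted onto some other $2$-arc on distinct vertices; two distinct vertices are adjacent iff the corresponding $2$-arcs share at least one vertex of $G$. -}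

module Defs where

open import Data.Nat using (ℕ; zero; suc; _+_; _*_; _∸_; _≡ᵇ_; _<ᵇ_; _≤ᵇ_)
open import Data.Nat.Combinatorics using (_C_)
open import Data.Bool using (Bool; true; false; if_then_else_; _∧_; _∨_; not; _xor_)
open import Data.Fin using (Fin; zero; suc; toℕ)
open import Relation.Binary.PropositionalEquality using (_≡_)

record Graph (n : ℕ) : Set where
  field
    adj    : Fin n → Fin n → Bool
    sym    : ∀ i j → adj i j ≡ adj j i
    irrefl : ∀ i → adj i i ≡ false
open Graph public

countF : ∀ {n} → (Fin n → Bool) → ℕ
countF {zero}  p = 0
countF {suc n} p = (if p zero then 1 else 0) + countF (λ i → p (suc i))

sumF : ∀ {n} → (Fin n → ℕ) → ℕ
sumF {zero}  f = 0
sumF {suc n} f = f zero + sumF (λ i → f (suc i))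

anyF : ∀ {n} → (Fin n → Bool) → Bool
anyF {zero}  p = false
anyF {suc n} p = p zero ∨ anyF (λ i → p (suc i))

_==_ : ∀ {n} → Fin n → Fin n → Bool
i == j = toℕ i ≡ᵇ toℕ j

_≠_ : ∀ {n} → Fin n → Fin n → Bool
i ≠ j = not (i == j)

data Reach {n : ℕ} (G : Graph n) : Fin n → Fin n → Set where
  here : ∀ {u} → Reach G u u
  step : ∀ {u v w} → adj G u v ≡ true → Reach G v w → Reach G u w

Connected : ∀ {n} → Graph n → Set
Connected {n} G = ∀ (u v : Fin n) → Reach G u v

module _ {n : ℕ} (G : Graph n) where

  deg : Fin n → ℕ
  deg u = countF (adj G u)

  pendant : Fin n → Bool
  pendant v = deg v ≡ᵇ 1

  deg2 : Fin n → Bool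
  deg2 v = deg v ≡ᵇ 2

  internal : Fin n → Bool
  internal u = 2 ≤ᵇ deg u

  closedNbr : Fin n → Fin n → Bool
  closedNbr u v = adj G u v ∨ (v == u)

  ideg : Fin n → ℕ
  ideg u = deg u ∸ countF (λ v → closedNbr u v ∧ pendant v)

  nPend : Fin n → ℕ
  nPend u = countF (λ v → adj G u v ∧ pendant v)

  -- triangles {u,v,w} containing u, counted as unordered pairs {v,w} (v < w)
  isTri : Fin n → Fin n → Fin n → Bool
  isTri u v w = adj G u v ∧ adj G u w ∧ adj G v w ∧ (toℕ v <ᵇ toℕ w)

  kTri : Fin n → ℕ
  kTri u = sumF (λ v → countF (λ w → isTri u v w ∧ deg2 v ∧ deg2 w))

  pTri : Fin n → ℕ
  pTri u = sumF (λ v → countF (λ w → isTri u v w ∧ (deg2 v xor deg2 w)))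

  is2Arc : Fin n → Fin n → Fin n → Bool
  is2Arc x u y = (x ≠ u) ∧ (u ≠ y) ∧ (x ≠ y) ∧ adj G x u ∧ adj G u y

  -- (x,u,y) can be shunted onto (u,y,z): x,u,y,z pairwise distinct and yz ∈ E
  shuntable : Fin n → Fin n → Fin n → Bool
  shuntable x u y = anyF (λ z → (z ≠ x) ∧ (z ≠ u) ∧ (z ≠ y) ∧ adj G y z)

  A2Vertex : Fin n → Fin n → Fin n → Bool
  A2Vertex x u y = is2Arc x u y ∧ shuntable x u y

  A2Order : ℕ
  A2Order = sumF (λ x → sumF (λ u → countF (λ y → A2Vertex x u y)))

  term : Fin n → ℕ
  term u = ((nPend u * ideg u + 2 * (ideg u C 2)) ∸ 2 * kTri u) ∸ pTri u

  formula : ℕ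
  formula = sumF (λ u → if internal u then term u else 0)

module Submission where

-- Count the vertices (x, u, y) of A₂(G) by their middle vertex u.  For distinct
-- neighbours x, y of u we have deg y = 1 + [xy ∈ E] + c, where c counts the
-- vertices z ∉ {x, u, y} adjacent to y, and (x, u, y) can be shunted iff c > 0.
-- Hence among the 2-arcs through u ending in a non-pendant vertex y, of which
-- there are I·(deg u − 1) for the number I of non-pendant neighbours of u
-- (I = ideg u when u is internal), the non-shuntable ones are exactly
-- those in which x u y is a triangle and deg y = 2; read as ordered pairs (x, y)
-- they number 2 k_u + p_u.  Finally I·(n_u + I − 1) = n_u I + 2 (I choose 2),
-- and when deg u ≤ 1 both sides vanish.  The count is local at every u.

open import Defs hiding (sym)
open Graph using () renaming (sym to adj-sym)
open import Data.Nat using (ℕ; zero; suc; _+_; _*_; _∸_; _≡ᵇ_; _<ᵇ_; _≤ᵇ_; _<_; _≮_)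
open import Data.Nat.Properties
open import Data.Nat.Combinatorics using (_C_; nCk+nC[k+1]≡[n+1]C[k+1]; nC1≡n)
open import Data.Nat.Solver using (module +-*-Solver)
open import Algebra.Properties.CommutativeSemigroup +-commutativeSemigroup using (interchange)
open import Data.Bool using (Bool; true; false; if_then_else_; _∧_; not; _xor_; T)
open import Data.Bool.Properties using (∧-assoc; ∧-comm; ∧-zeroʳ; ∧-identityʳ; ∨-identityʳ)
open import Data.Fin using (Fin; zero; suc; toℕ)
open import Data.Fin.Properties using (toℕ-injective)
open import Data.Unit using (tt)
open import Data.Empty using (⊥-elim)
open import Function using (_∘_; case_of_)
open import Relation.Binary.PropositionalEquality

bit : Bool → ℕ
bit b = if b then 1 else 0

sumF² : ∀ {m n} → (Fin m → Fin n → ℕ) → ℕ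
sumF² f = sumF (λ i → sumF (f i))

sumF-cong : ∀ {n} {f g : Fin n → ℕ} → (∀ i → f i ≡ g i) → sumF f ≡ sumF g
sumF-cong {zero}  f≗g = refl
sumF-cong {suc n} f≗g = cong₂ _+_ (f≗g zero) (sumF-cong (f≗g ∘ suc))

countF-cong : ∀ {n} {p q : Fin n → Bool} → (∀ i → p i ≡ q i) → countF p ≡ countF q
countF-cong {zero}  p≗q = refl
countF-cong {suc n} p≗q = cong₂ (λ b c → bit b + c) (p≗q zero) (countF-cong (p≗q ∘ suc))

countF≡sumF-bit : ∀ {n} (p : Fin n → Bool) → countF p ≡ sumF (bit ∘ p)
countF≡sumF-bit {zero}  p = refl
countF≡sumF-bit {suc n} p = cong (bit (p zero) +_) (countF≡sumF-bit (p ∘ suc))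

sumF-countF≡sumF²-bit : ∀ {m n} (p : Fin m → Fin n → Bool) →
                         sumF (λ i → countF (p i)) ≡ sumF² (λ i j → bit (p i j))
sumF-countF≡sumF²-bit p = sumF-cong (λ i → countF≡sumF-bit (p i))

sumF-zero : ∀ n → sumF {n} (λ _ → 0) ≡ 0
sumF-zero zero    = refl
sumF-zero (suc n) = sumF-zero n

sumF-+ : ∀ {n} (f g : Fin n → ℕ) → sumF (λ i → f i + g i) ≡ sumF f + sumF g
sumF-+ {zero}  f g = refl
sumF-+ {suc n} f g = trans (cong (f zero + g zero +_) (sumF-+ (f ∘ suc) (g ∘ suc)))
                           (interchange (f zero) (g zero) (sumF (f ∘ suc)) (sumF (g ∘ suc)))

sumF-*ˡ : ∀ {n} c (f : Fin n → ℕ) → sumF (λ i → c * f i) ≡ c * sumF f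
sumF-*ˡ {zero}  c f = sym (*-zeroʳ c)
sumF-*ˡ {suc n} c f = trans (cong (c * f zero +_) (sumF-*ˡ c (f ∘ suc)))
                            (sym (*-distribˡ-+ c (f zero) (sumF (f ∘ suc))))

sumF-*ʳ : ∀ {n} (f : Fin n → ℕ) c → sumF (λ i → f i * c) ≡ sumF f * c
sumF-*ʳ {zero}  f c = refl
sumF-*ʳ {suc n} f c = trans (cong (f zero * c +_) (sumF-*ʳ (f ∘ suc) c))
                            (sym (*-distribʳ-+ c (f zero) (sumF (f ∘ suc))))

sumF-comm : ∀ {m n} (f : Fin m → Fin n → ℕ) → sumF² f ≡ sumF² (λ j i → f i j)
sumF-comm {zero}  {n} f = sym (sumF-zero n)
sumF-comm {suc m}     f = trans (cong (sumF (f zero) +_) (sumF-comm (f ∘ suc)))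
                                (sym (sumF-+ (f zero) (λ j → sumF (λ i → f (suc i) j))))

sumF²-+ : ∀ {m n} (f g : Fin m → Fin n → ℕ) → sumF² (λ i j → f i j + g i j) ≡ sumF² f + sumF² g
sumF²-+ f g = trans (sumF-cong (λ i → sumF-+ (f i) (g i))) (sumF-+ (λ i → sumF (f i)) (λ i → sumF (g i)))

sumF²-*ˡ : ∀ {m n} c (f : Fin m → Fin n → ℕ) → sumF² (λ i j → c * f i j) ≡ c * sumF² f
sumF²-*ˡ c f = trans (sumF-cong (λ i → sumF-*ˡ c (f i))) (sumF-*ˡ c (λ i → sumF (f i)))

sumF-bit-∧ˡ : ∀ {n} b (p : Fin n → Bool) → sumF (λ i → bit (b ∧ p i)) ≡ bit b * countF p
sumF-bit-∧ˡ {n} false p = sumF-zero n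
sumF-bit-∧ˡ     true  p = trans (sym (countF≡sumF-bit p)) (sym (+-identityʳ _))

bit-partition : ∀ a b → bit a ≡ bit (a ∧ b) + bit (a ∧ not b)
bit-partition false _     = refl
bit-partition true  false = refl
bit-partition true  true  = refl

countF-partition : ∀ {n} (p q : Fin n → Bool) →
                   countF p ≡ countF (λ i → p i ∧ q i) + countF (λ i → p i ∧ not (q i))
countF-partition p q = begin
    countF p
  ≡⟨ countF≡sumF-bit p ⟩
    sumF (bit ∘ p)
  ≡⟨ sumF-cong (λ i → bit-partition (p i) (q i)) ⟩
    sumF (λ i → bit (p i ∧ q i) + bit (p i ∧ not (q i)))
  ≡⟨ sumF-+ (λ i → bit (p i ∧ q i)) (λ i → bit (p i ∧ not (q i))) ⟩
    sumF (λ i → bit (p i ∧ q i)) + sumF (λ i → bit (p i ∧ not (q i)))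
  ≡⟨ sym (cong₂ _+_ (countF≡sumF-bit (λ i → p i ∧ q i)) (countF≡sumF-bit (λ i → p i ∧ not (q i)))) ⟩
    countF (λ i → p i ∧ q i) + countF (λ i → p i ∧ not (q i))
  ∎
  where open ≡-Reasoning

countF-remove : ∀ {n} (a : Fin n) (p : Fin n → Bool) → countF (λ z → (z ≠ a) ∧ p z) + bit (p a) ≡ countF p
countF-remove {suc n} zero    p = +-comm (countF (p ∘ suc)) (bit (p zero))
countF-remove {suc n} (suc a) p = trans (+-assoc (bit (p zero)) _ _)
                                        (cong (bit (p zero) +_) (countF-remove a (p ∘ suc)))

anyF≡0<ᵇcountF : ∀ {n} (p : Fin n → Bool) → anyF p ≡ (0 <ᵇ countF p)
anyF≡0<ᵇcountF {zero}  p = refl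
anyF≡0<ᵇcountF {suc n} p with p zero
... | true  = refl
... | false = anyF≡0<ᵇcountF (p ∘ suc)

==⇒≡ : ∀ {n} {i j : Fin n} → (i == j) ≡ true → i ≡ j
==⇒≡ {i = i} {j} i==j = toℕ-injective (≡ᵇ⇒≡ (toℕ i) (toℕ j) (subst T (sym i==j) tt))

<ᵇ≡true⇒< : ∀ m n → (m <ᵇ n) ≡ true → m < n
<ᵇ≡true⇒< m n m<ᵇn = <ᵇ⇒< m n (subst T (sym m<ᵇn) tt)

<ᵇ≡false⇒≮ : ∀ {m n} → (m <ᵇ n) ≡ false → m ≮ n
<ᵇ≡false⇒≮ m≮ᵇn m<n = subst T m≮ᵇn (<⇒<ᵇ m<n)

split-by-order : ∀ {n} (f : Fin n → Fin n → ℕ) → (∀ v → f v v ≡ 0) → ∀ v w →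
                 f v w ≡ (if toℕ v <ᵇ toℕ w then f v w else 0) + (if toℕ w <ᵇ toℕ v then f v w else 0)
split-by-order f f-diag v w with toℕ v <ᵇ toℕ w in v<w | toℕ w <ᵇ toℕ v in w<v
... | true  | true  = ⊥-elim (<-asym (<ᵇ≡true⇒< (toℕ v) (toℕ w) v<w) (<ᵇ≡true⇒< (toℕ w) (toℕ v) w<v))
... | true  | false = sym (+-identityʳ _)
... | false | true  = refl
... | false | false with toℕ-injective {i = v} {j = w} (≤-antisym (≮⇒≥ (<ᵇ≡false⇒≮ w<v)) (≮⇒≥ (<ᵇ≡false⇒≮ v<w)))
...   | refl = f-diag v

sumF²-by-order : ∀ {n} (f : Fin n → Fin n → ℕ) → (∀ v → f v v ≡ 0) →
                 sumF² f ≡ sumF² (λ v w → if toℕ v <ᵇ toℕ w then f v w + f w v else 0)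
sumF²-by-order f f-diag = begin
    sumF² f
  ≡⟨ sumF-cong (λ v → sumF-cong (split-by-order f f-diag v)) ⟩
    sumF² (λ v w → below v w + above v w)
  ≡⟨ sumF²-+ below above ⟩
    sumF² below + sumF² above
  ≡⟨ cong (sumF² below +_) (sumF-comm above) ⟩
    sumF² below + sumF² (λ v w → above w v)
  ≡⟨ sym (sumF²-+ below (λ v w → above w v)) ⟩
    sumF² (λ v w → below v w + above w v)
  ≡⟨ sumF-cong (λ v → sumF-cong (λ w → if-+ {f v w} {f w v} (toℕ v <ᵇ toℕ w))) ⟩
    sumF² (λ v w → if toℕ v <ᵇ toℕ w then f v w + f w v else 0)
  ∎
  where
  open ≡-Reasoning
  below above : Fin _ → Fin _ → ℕ
  below v w = if toℕ v <ᵇ toℕ w then f v w else 0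
  above v w = if toℕ w <ᵇ toℕ v then f v w else 0
  if-+ : ∀ {a b} l → (if l then a else 0) + (if l then b else 0) ≡ (if l then a + b else 0)
  if-+ true  = refl
  if-+ false = refl

bit+bit≡2*bit∧+bit-xor : ∀ a b → bit a + bit b ≡ 2 * bit (a ∧ b) + bit (a xor b)
bit+bit≡2*bit∧+bit-xor false false = refl
bit+bit≡2*bit∧+bit-xor false true  = refl
bit+bit≡2*bit∧+bit-xor true  false = refl
bit+bit≡2*bit∧+bit-xor true  true  = refl

-- suc (bit t + c) is the degree of y as computed by deg-along-2arc.
bit-0<+bit-deg2 : ∀ t c → bit (0 <ᵇ c) + bit (t ∧ (suc (bit t + c) ≡ᵇ 2)) ≡ bit (not (suc (bit t + c) ≡ᵇ 1))
bit-0<+bit-deg2 false zero    = refl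
bit-0<+bit-deg2 false (suc c) = refl
bit-0<+bit-deg2 true  zero    = refl
bit-0<+bit-deg2 true  (suc c) = refl

2≤ᵇm⇒m≢ᵇ1 : ∀ m → (2 ≤ᵇ m) ≡ true → (m ≡ᵇ 1) ≡ false
2≤ᵇm⇒m≢ᵇ1 (suc (suc m)) _ = refl

2≰ᵇm⇒m∸1≡0 : ∀ m → (2 ≤ᵇ m) ≡ false → m ∸ 1 ≡ 0
2≰ᵇm⇒m∸1≡0 zero          _ = refl
2≰ᵇm⇒m∸1≡0 (suc zero)    _ = refl

2*nC2≡n*[n∸1] : ∀ n → 2 * (n C 2) ≡ n * (n ∸ 1)
2*nC2≡n*[n∸1] zero          = refl
2*nC2≡n*[n∸1] (suc zero)    = refl
2*nC2≡n*[n∸1] (suc (suc n)) = begin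
    2 * (suc (suc n) C 2)
  ≡⟨ cong (2 *_) (sym (nCk+nC[k+1]≡[n+1]C[k+1] (suc n) 1)) ⟩
    2 * (suc n C 1 + suc n C 2)
  ≡⟨ *-distribˡ-+ 2 (suc n C 1) (suc n C 2) ⟩
    2 * (suc n C 1) + 2 * (suc n C 2)
  ≡⟨ cong₂ (λ a b → 2 * a + b) (nC1≡n (suc n)) (2*nC2≡n*[n∸1] (suc n)) ⟩
    2 * suc n + suc n * n
  ≡⟨ solve 1 (λ n → con 2 :* (con 1 :+ n) :+ (con 1 :+ n) :* n := (con 2 :+ n) :* (con 1 :+ n)) refl n ⟩
    suc (suc n) * suc n
  ∎
  where
  open ≡-Reasoning
  open +-*-Solver

m*[n+m∸1]≡n*m+2*mC2 : ∀ n m → m * (n + m ∸ 1) ≡ n * m + 2 * (m C 2)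
m*[n+m∸1]≡n*m+2*mC2 n zero    = sym (trans (+-identityʳ (n * 0)) (*-zeroʳ n))
m*[n+m∸1]≡n*m+2*mC2 n (suc m) = begin
    suc m * (n + suc m ∸ 1)
  ≡⟨ cong (λ k → suc m * (k ∸ 1)) (+-suc n m) ⟩
    suc m * (n + m)
  ≡⟨ solve 2 (λ n m → (con 1 :+ m) :* (n :+ m) := n :* (con 1 :+ m) :+ (con 1 :+ m) :* m) refl n m ⟩
    n * suc m + suc m * m
  ≡⟨ cong (n * suc m +_) (sym (2*nC2≡n*[n∸1] (suc m))) ⟩
    n * suc m + 2 * (suc m C 2)
  ∎
  where
  open ≡-Reasoning
  open +-*-Solver

module _ {n : ℕ} (G : Graph n) where

  adj⇒≠ : ∀ {a b} → adj G a b ≡ true → (a == b) ≡ false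
  adj⇒≠ {a} {b} ab with a == b in a==b
  ... | false = refl
  ... | true with ==⇒≡ {i = a} {b} a==b
  ...   | refl = case trans (sym (irrefl G a)) ab of λ ()

  -- shuntable x u y unfolds to anyF (continues x u y).
  continues : Fin n → Fin n → Fin n → Fin n → Bool
  continues x u y z = (z ≠ x) ∧ (z ≠ u) ∧ (z ≠ y) ∧ adj G y z

  deg-along-2arc : ∀ {x u y} → adj G u x ≡ true → adj G u y ≡ true → (x == y) ≡ false →
                   deg G y ≡ suc (bit (adj G x y) + countF (continues x u y))
  deg-along-2arc {x} {u} {y} ux uy x≢y = begin
      deg G y
    ≡⟨ sym (countF-remove y (adj G y)) ⟩
      countF notY + bit (adj G y y)
    ≡⟨ cong₂ _+_ (sym (countF-remove u notY)) (cong bit (irrefl G y)) ⟩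
      countF notUY + bit (notY u) + 0
    ≡⟨ cong₂ (λ c b → c + bit b + 0) (sym (countF-remove x notUY)) notY-u ⟩
      countF (continues x u y) + bit (notUY x) + 1 + 0
    ≡⟨ cong (λ b → countF (continues x u y) + bit b + 1 + 0) notUY-x ⟩
      countF (continues x u y) + bit (adj G x y) + 1 + 0
    ≡⟨ solve 2 (λ c t → c :+ t :+ con 1 :+ con 0 := con 1 :+ (t :+ c)) refl (countF (continues x u y)) (bit (adj G x y)) ⟩
      suc (bit (adj G x y) + countF (continues x u y))
    ∎
    where
    open ≡-Reasoning
    open +-*-Solver
    notY notUY : Fin n → Bool
    notY z = (z ≠ y) ∧ adj G y z
    notUY z = (z ≠ u) ∧ notY z
    notY-u : notY u ≡ true
    notY-u rewrite adj⇒≠ uy | adj-sym G y u = uy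
    notUY-x : notUY x ≡ adj G x y
    notUY-x rewrite adj⇒≠ (trans (adj-sym G x u) ux) | x≢y | adj-sym G y x = refl

  arcIntoNonPendant : Fin n → Fin n → Fin n → Bool
  arcIntoNonPendant x u y = (adj G u y ∧ not (pendant G y)) ∧ ((x ≠ y) ∧ adj G u x)

  stuckTriangleArc : Fin n → Fin n → Fin n → Bool
  stuckTriangleArc x u y = adj G u x ∧ (adj G u y ∧ (adj G x y ∧ deg2 G y))

  A2Vertex+stuckTriangleArc : ∀ x u y →
    bit (A2Vertex G x u y) + bit (stuckTriangleArc x u y) ≡ bit (arcIntoNonPendant x u y)
  A2Vertex+stuckTriangleArc x u y rewrite adj-sym G x u with adj G u x in ux
  ... | false rewrite ∧-zeroʳ (x ≠ y) | ∧-zeroʳ (u ≠ y) | ∧-zeroʳ (x ≠ u)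
                    | ∧-zeroʳ (adj G u y ∧ not (pendant G y)) = refl
  ... | true with adj G u y in uy
  ...   | false rewrite ∧-zeroʳ (x ≠ y) | ∧-zeroʳ (u ≠ y) | ∧-zeroʳ (x ≠ u) = refl
  ...   | true rewrite adj⇒≠ (trans (adj-sym G x u) ux) | adj⇒≠ uy with x == y in x=y
  ...     | false rewrite ∧-identityʳ (not (pendant G y)) | anyF≡0<ᵇcountF (continues x u y)
                        | deg-along-2arc ux uy x=y = bit-0<+bit-deg2 (adj G x y) (countF (continues x u y))
  ...     | true with ==⇒≡ {i = x} {y} x=y
  ...       | refl rewrite irrefl G x | ∧-zeroʳ (not (pendant G x)) = refl

  nonPendantNbrs : Fin n → ℕ
  nonPendantNbrs u = countF (λ y → adj G u y ∧ not (pendant G y))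

  sumF²-arcIntoNonPendant : ∀ u → sumF² (λ x y → bit (arcIntoNonPendant x u y)) ≡ nonPendantNbrs u * (deg G u ∸ 1)
  sumF²-arcIntoNonPendant u = begin
      sumF² (λ x y → bit (arcIntoNonPendant x u y))
    ≡⟨ sumF-comm (λ x y → bit (arcIntoNonPendant x u y)) ⟩
      sumF² (λ y x → bit (arcIntoNonPendant x u y))
    ≡⟨ sumF-cong arcsInto ⟩
      sumF (λ y → bit (adj G u y ∧ not (pendant G y)) * (deg G u ∸ 1))
    ≡⟨ sumF-*ʳ (λ y → bit (adj G u y ∧ not (pendant G y))) (deg G u ∸ 1) ⟩
      sumF (λ y → bit (adj G u y ∧ not (pendant G y))) * (deg G u ∸ 1)
    ≡⟨ cong (_* (deg G u ∸ 1)) (sym (countF≡sumF-bit (λ y → adj G u y ∧ not (pendant G y)))) ⟩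
      nonPendantNbrs u * (deg G u ∸ 1)
    ∎
    where
    open ≡-Reasoning
    otherNbrs : ∀ y → adj G u y ≡ true → countF (λ x → (x ≠ y) ∧ adj G u x) ≡ deg G u ∸ 1
    otherNbrs y uy = begin
        countF (λ x → (x ≠ y) ∧ adj G u x)
      ≡⟨ sym (m+n∸n≡m _ 1) ⟩
        countF (λ x → (x ≠ y) ∧ adj G u x) + bit true ∸ 1
      ≡⟨ cong (λ b → countF (λ x → (x ≠ y) ∧ adj G u x) + bit b ∸ 1) (sym uy) ⟩
        countF (λ x → (x ≠ y) ∧ adj G u x) + bit (adj G u y) ∸ 1
      ≡⟨ cong (_∸ 1) (countF-remove y (adj G u)) ⟩
        deg G u ∸ 1
      ∎
    arcsInto : ∀ y → sumF (λ x → bit (arcIntoNonPendant x u y))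
                     ≡ bit (adj G u y ∧ not (pendant G y)) * (deg G u ∸ 1)
    arcsInto y with adj G u y in uy
    ... | false = sumF-zero n
    ... | true  = trans (sumF-bit-∧ˡ (not (pendant G y)) (λ x → (x ≠ y) ∧ adj G u x))
                        (cong (bit (not (pendant G y)) *_) (otherNbrs y uy))

  isTri≡<ᵇ∧triangle : ∀ u v w → isTri G u v w ≡ (toℕ v <ᵇ toℕ w) ∧ (adj G u v ∧ (adj G u w ∧ adj G v w))
  isTri≡<ᵇ∧triangle u v w = begin
      a ∧ (b ∧ (c ∧ l))
    ≡⟨ cong (a ∧_) (sym (∧-assoc b c l)) ⟩
      a ∧ ((b ∧ c) ∧ l)
    ≡⟨ sym (∧-assoc a (b ∧ c) l) ⟩
      (a ∧ (b ∧ c)) ∧ l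
    ≡⟨ ∧-comm (a ∧ (b ∧ c)) l ⟩
      l ∧ (a ∧ (b ∧ c))
    ∎
    where
    open ≡-Reasoning
    a b c l : Bool
    a = adj G u v
    b = adj G u w
    c = adj G v w
    l = toℕ v <ᵇ toℕ w

  stuckTriangleArc-pair : ∀ u v w →
    (if toℕ v <ᵇ toℕ w then bit (stuckTriangleArc v u w) + bit (stuckTriangleArc w u v) else 0)
    ≡ 2 * bit (isTri G u v w ∧ (deg2 G v ∧ deg2 G w)) + bit (isTri G u v w ∧ (deg2 G v xor deg2 G w))
  stuckTriangleArc-pair u v w rewrite isTri≡<ᵇ∧triangle u v w | adj-sym G w v with toℕ v <ᵇ toℕ w
  ... | false = refl
  ... | true with adj G u v | adj G u w | adj G v w
  ...   | false | false | _     = refl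
  ...   | false | true  | _     = refl
  ...   | true  | false | _     = refl
  ...   | true  | true  | false = refl
  ...   | true  | true  | true  = trans (+-comm (bit (deg2 G w)) (bit (deg2 G v)))
                                        (bit+bit≡2*bit∧+bit-xor (deg2 G v) (deg2 G w))

  sumF²-stuckTriangleArc : ∀ u → sumF² (λ x y → bit (stuckTriangleArc x u y)) ≡ 2 * kTri G u + pTri G u
  sumF²-stuckTriangleArc u = begin
      sumF² (λ x y → bit (stuckTriangleArc x u y))
    ≡⟨ sumF²-by-order (λ x y → bit (stuckTriangleArc x u y)) stuck-diag ⟩
      sumF² (λ v w → if toℕ v <ᵇ toℕ w then bit (stuckTriangleArc v u w) + bit (stuckTriangleArc w u v) else 0)
    ≡⟨ sumF-cong (λ v → sumF-cong (stuckTriangleArc-pair u v)) ⟩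
      sumF² (λ v w → 2 * bit (K v w) + bit (P v w))
    ≡⟨ sumF²-+ (λ v w → 2 * bit (K v w)) (λ v w → bit (P v w)) ⟩
      sumF² (λ v w → 2 * bit (K v w)) + sumF² (λ v w → bit (P v w))
    ≡⟨ cong (_+ sumF² (λ v w → bit (P v w))) (sumF²-*ˡ 2 (λ v w → bit (K v w))) ⟩
      2 * sumF² (λ v w → bit (K v w)) + sumF² (λ v w → bit (P v w))
    ≡⟨ sym (cong₂ (λ k p → 2 * k + p) (sumF-countF≡sumF²-bit K) (sumF-countF≡sumF²-bit P)) ⟩
      2 * kTri G u + pTri G u
    ∎
    where
    open ≡-Reasoning
    K P : Fin n → Fin n → Bool
    K v w = isTri G u v w ∧ (deg2 G v ∧ deg2 G w)
    P v w = isTri G u v w ∧ (deg2 G v xor deg2 G w)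
    stuck-diag : ∀ v → bit (stuckTriangleArc v u v) ≡ 0
    stuck-diag v rewrite irrefl G v | ∧-zeroʳ (adj G u v) | ∧-zeroʳ (adj G u v) = refl

  A2VerticesThrough : Fin n → ℕ
  A2VerticesThrough u = sumF (λ x → countF (λ y → A2Vertex G x u y))

  A2VerticesThrough≡ : ∀ u →
    A2VerticesThrough u ≡ nonPendantNbrs u * (deg G u ∸ 1) ∸ (2 * kTri G u + pTri G u)
  A2VerticesThrough≡ u = begin
      A2VerticesThrough u
    ≡⟨ sym (m+n∸n≡m (A2VerticesThrough u) (sumF² stuck)) ⟩
      A2VerticesThrough u + sumF² stuck ∸ sumF² stuck
    ≡⟨ cong₂ _∸_ arcs (sumF²-stuckTriangleArc u) ⟩
      nonPendantNbrs u * (deg G u ∸ 1) ∸ (2 * kTri G u + pTri G u)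
    ∎
    where
    open ≡-Reasoning
    stuck : Fin n → Fin n → ℕ
    stuck x y = bit (stuckTriangleArc x u y)
    arcs : A2VerticesThrough u + sumF² stuck ≡ nonPendantNbrs u * (deg G u ∸ 1)
    arcs = begin
        A2VerticesThrough u + sumF² stuck
      ≡⟨ cong (_+ sumF² stuck) (sumF-countF≡sumF²-bit (λ x y → A2Vertex G x u y)) ⟩
        sumF² (λ x y → bit (A2Vertex G x u y)) + sumF² stuck
      ≡⟨ sym (sumF²-+ (λ x y → bit (A2Vertex G x u y)) stuck) ⟩
        sumF² (λ x y → bit (A2Vertex G x u y) + stuck x y)
      ≡⟨ sumF-cong (λ x → sumF-cong (A2Vertex+stuckTriangleArc x u)) ⟩
        sumF² (λ x y → bit (arcIntoNonPendant x u y))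
      ≡⟨ sumF²-arcIntoNonPendant u ⟩
        nonPendantNbrs u * (deg G u ∸ 1)
      ∎

  deg≡nPend+nonPendantNbrs : ∀ u → deg G u ≡ nPend G u + nonPendantNbrs u
  deg≡nPend+nonPendantNbrs u = countF-partition (adj G u) (pendant G)

  ideg≡nonPendantNbrs : ∀ u → pendant G u ≡ false → ideg G u ≡ nonPendantNbrs u
  ideg≡nonPendantNbrs u pu = begin
      deg G u ∸ countF (λ v → closedNbr G u v ∧ pendant G v)
    ≡⟨ cong₂ _∸_ (deg≡nPend+nonPendantNbrs u) (countF-cong pendantInClosedNbr) ⟩
      nPend G u + nonPendantNbrs u ∸ nPend G u
    ≡⟨ m+n∸m≡n (nPend G u) (nonPendantNbrs u) ⟩
      nonPendantNbrs u
    ∎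
    where
    open ≡-Reasoning
    pendantInClosedNbr : ∀ v → closedNbr G u v ∧ pendant G v ≡ adj G u v ∧ pendant G v
    pendantInClosedNbr v with v == u in v=u
    ... | false = cong (_∧ pendant G v) (∨-identityʳ (adj G u v))
    ... | true with ==⇒≡ {i = v} {u} v=u
    ...   | refl rewrite irrefl G v | pu = refl

  A2VerticesThrough≡summand : ∀ u → A2VerticesThrough u ≡ (if internal G u then term G u else 0)
  A2VerticesThrough≡summand u with internal G u in int
  ... | false = begin
      A2VerticesThrough u
    ≡⟨ A2VerticesThrough≡ u ⟩
      nonPendantNbrs u * (deg G u ∸ 1) ∸ (2 * kTri G u + pTri G u)
    ≡⟨ cong (λ d → nonPendantNbrs u * d ∸ (2 * kTri G u + pTri G u)) (2≰ᵇm⇒m∸1≡0 (deg G u) int) ⟩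
      nonPendantNbrs u * 0 ∸ (2 * kTri G u + pTri G u)
    ≡⟨ cong (_∸ (2 * kTri G u + pTri G u)) (*-zeroʳ (nonPendantNbrs u)) ⟩
      0 ∸ (2 * kTri G u + pTri G u)
    ≡⟨ 0∸n≡0 (2 * kTri G u + pTri G u) ⟩
      0
    ∎
    where open ≡-Reasoning
  ... | true = begin
      A2VerticesThrough u
    ≡⟨ A2VerticesThrough≡ u ⟩
      nonPendantNbrs u * (deg G u ∸ 1) ∸ (2 * kTri G u + pTri G u)
    ≡⟨ sym (∸-+-assoc (nonPendantNbrs u * (deg G u ∸ 1)) (2 * kTri G u) (pTri G u)) ⟩
      nonPendantNbrs u * (deg G u ∸ 1) ∸ 2 * kTri G u ∸ pTri G u
    ≡⟨ cong (λ m → m ∸ 2 * kTri G u ∸ pTri G u) arcsIntoNonPendant ⟩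
      term G u
    ∎
    where
    open ≡-Reasoning
    arcsIntoNonPendant : nonPendantNbrs u * (deg G u ∸ 1) ≡ nPend G u * ideg G u + 2 * (ideg G u C 2)
    arcsIntoNonPendant rewrite ideg≡nonPendantNbrs u (2≤ᵇm⇒m≢ᵇ1 (deg G u) int) | deg≡nPend+nonPendantNbrs u
      = m*[n+m∸1]≡n*m+2*mC2 (nPend G u) (nonPendantNbrs u)

mainTheorem10 : (n : ℕ) (G : Graph n) → Connected G → A2Order G ≡ formula G
mainTheorem10 n G _ = begin
    A2Order G
  ≡⟨ sumF-comm (λ x u → countF (λ y → A2Vertex G x u y)) ⟩
    sumF (A2VerticesThrough G)
  ≡⟨ sumF-cong (A2VerticesThrough≡summand G) ⟩
    formula G
  ∎
  where open ≡-Reasoning
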